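{- Let $n \ge 1$, let $S_1, \ldots, S_n$ be finite sets with $|S_k| \ge 2$ for each $k$, let $Q = S_1 \times \cdots \times S_n$, let $\delta \in [0,1/2]$, and let $\mathcal{A}$ be a collection of hyperplanes in $Q$, no two of which are parallel. Let $\alpha_k$ and $\mathbb{P}_k$ be defined from $\mathcal{A}$ and $\delta$ as in the context. Then for each $1 \le k \le n$, $$\mathbb{E}_{k-1}\big[\alpha_k(x)^2\big] \le \frac{1}{|S_k|^2} \prod_{j=1}^{k-1}\Big(1 + \frac{3}{(1-\delta)|S_j|}\Big).$$
   Context: For $0 \le k \le n$ let $Q_k = S_1 \times \cdots \times S_k$ ($Q_0$ is a one-point set). A hyperplane in $Q$ is a set $A = Y_1 \times \cdots \times Y_n$ where each $Y_i$ is either $S_i$ or a single element of $S_i$; its set of fixed coordinates is $F(A) = \{k : Y_k \ne S_k\}$. Two hyperplanes $A, A'$ are parallel if $F(A) = F(A')$. A subset $X \subseteq Q_k$ is identified with $X \times S_{k+1} \times \cdots \times S_n \subseteq Q$. For $1 \le k \le n$ let $\mathcal{A}_k = \{A \in \mathcal{A} : \max F(A) = k\}$ and $B_k = \bigcup_{A \in \mathcal{A}_k} A$, regarded as a subset of $Q_k$. Write elements of $Q_k$ as pairs $(x,y)$ with $x \in Q_{k-1}$, $y \in S_k$. For $x \in Q_{k-1}$ set $\alpha_k(x) = |\{y \in S_k : (x,y) \in B_k\}| / |S_k|$. Define probability measures $\mathbb{P}_k$ on $Q_k$ recursively: $\mathbb{P}_0$ is the unique probability measure on $Q_0$, and for $1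 \le k \le n$ and $(x,y) \in Q_k$, $$\mathbb{P}_k(x,y) = \max\Big\{0, \frac{\alpha_k(x) - \delta}{\alpha_k(x)(1-\delta)}\Big\} \cdot \frac{\mathbb{P}_{k-1}(x)}{|S_k|} \text{ if } (x,y) \in B_k,$$ $$\mathbb{P}_k(x,y) = \min\Big\{\frac{1}{1-\alpha_k(x)}, \frac{1}{1-\delta}\Big\} \cdot \frac{\mathbb{P}_{k-1}(x)}{|S_k|} \text{ if } (x,y) \notin B_k.$$ Each $\mathbb{P}_k$ is extended to a probability measure on $Q$ uniformly, i.e. $\mathbb{P}_k(x,z) = \mathbb{P}_k(x)/(|S_{k+1}|\cdots|S_n|)$ for $x \in Q_k$. $\mathbb{E}_{k-1}[\alpha_k(x)^2]$ denotes $\sum_{x \in Q_{k-1}} \alpha_k(x)^2 \, \mathbb{P}_{k-1}(x)$.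
   Formalization: The parameter δ takes only rational values in $[0,1/2]$. -}

module Defs where

open import Data.Bool using (Bool; true; false; _∧_; not; if_then_else_)
open import Data.Maybe using (Maybe; just; nothing; is-just)
open import Data.Nat as ℕ using (ℕ; zero; suc; _∸_; _<_)
open import Data.List using (List; []; _∷_; [_]; map; concatMap; upTo; filter; length; foldr)
open import Data.Bool.ListAction using (all; any)
open import Data.Integer using (+_)
open import Data.Rational as ℚ using (ℚ; 0ℚ; 1ℚ; _+_; _*_; _-_; _⊔_; _⊓_; _÷_; ≢-nonZero)
open import Data.Rational.Properties using (_≟_)
open import Relation.Nullary using (yes; no)
open import Relation.Binary.PropositionalEquality using (_≡_)
open import Relation.Unary using (Pred)

-- Conventions.
-- * Sizes: s : ℕ → ℕ, where |S_{i+1}| = s i (0-indexed coordinates i = 0 .. n-1).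
--   S_{i+1} is identified with {0, …, s i - 1}.
-- * A hyperplane is h : ℕ → Maybe ℕ; h i = nothing means Y_{i+1} = S_{i+1},
--   h i = just y means Y_{i+1} = {y}.  (Well-formedness is a hypothesis.)
-- * A point of Q_k is a list of length k stored in REVERSE order:
--   the head is the k-th coordinate (0-indexed k-1).

Hyp : Set
Hyp = ℕ → Maybe ℕ

fixed : Hyp → ℕ → Bool
fixed h i = is-just (h i)

WellFormed : ℕ → (ℕ → ℕ) → Hyp → Set
WellFormed n s h = ∀ i y → h i ≡ just y → (i < n) Data.Product.× (y < s i)
  where import Data.Product

Parallel : Hyp → Hyp → Set
Parallel h h' = ∀ i → fixed h i ≡ fixed h' i

-- total rational division a / b (b = 0 ↦ 0; never used in that case)
frac : ℕ → ℕ → ℚ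
frac a zero = 0ℚ
frac a (suc d) = + a ℚ./ suc d

div : ℚ → ℚ → ℚ
div p q with q ≟ 0ℚ
... | yes _ = 0ℚ
... | no q≢0 = _÷_ p q {{≢-nonZero q≢0}}

sumℚ : List ℚ → ℚ
sumℚ = foldr _+_ 0ℚ

prodℚ : List ℚ → ℚ
prodℚ = foldr _*_ 1ℚ

module Setup (n : ℕ) (s : ℕ → ℕ) (δ : ℚ) (𝒜 : List Hyp) where

  pts : ℕ → List (List ℕ)
  pts zero = [ [] ]
  pts (suc c) = concatMap (λ x → map (λ y → y ∷ x) (upTo (s c))) (pts c)

  okAt : Hyp → ℕ → ℕ → Bool
  okAt h i y with h i
  ... | nothing = true
  ... | just z = z ℕ.≡ᵇ y

  matches : Hyp → List ℕ → Bool
  matches h [] = true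
  matches h (y ∷ x) = okAt h (length x) y ∧ matches h x

  -- h ∈ 𝒜_{c+1} : max F(h) = c+1, i.e. 0-indexed coordinate c fixed, none after it (below n)
  inLevel : Hyp → ℕ → Bool
  inLevel h c = fixed h c ∧ all (λ i → not (fixed h (suc c ℕ.+ i))) (upTo (n ∸ suc c))

  -- membership of p ∈ Q_{c+1} in B_{c+1}
  inB : ℕ → List ℕ → Bool
  inB c p = any (λ h → inLevel h c ∧ matches h p) 𝒜

  -- α_{c+1}(x) for x ∈ Q_c
  α : ℕ → List ℕ → ℚ
  α c x = frac (length (filter (λ y → inB c (y ∷ x) Data.Bool.≟ true) (upTo (s c)))) (s c)
    where import Data.Bool

  factorIn : ℚ → ℚ
  factorIn a = 0ℚ ⊔ div (a - δ) (a * (1ℚ - δ))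

  factorOut : ℚ → ℚ
  factorOut a = div 1ℚ (1ℚ - a) ⊓ div 1ℚ (1ℚ - δ)

  ℙ : ℕ → List ℕ → ℚ
  ℙ zero [] = 1ℚ
  ℙ zero (_ ∷ _) = 0ℚ
  ℙ (suc c) [] = 0ℚ
  ℙ (suc c) (y ∷ x) =
    (if inB c (y ∷ x) then factorIn (α c x) else factorOut (α c x)) * ℙ c x * frac 1 (s c)

  Eα² : ℕ → ℚ
  Eα² c = sumℚ (map (λ x → α c x * α c x * ℙ c x) (pts c))

  bound : ℕ → ℚ
  bound c = frac 1 (s c) * frac 1 (s c)
          * prodℚ (map (λ j → 1ℚ + div (+ 3 ℚ./ 1) ((1ℚ - δ) * frac (s j) 1)) (upTo c))

module Submission where

-- Each point of B_k lies on a hyperplane of 𝒜_k, and such a hyperplane fixes the k-th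
-- coordinate, so α_k(x) ≤ m(x)/|S_k|, where m(x) is the number of hyperplanes of 𝒜_k whose
-- projection to Q_{k-1} contains x.  Hyperplanes of 𝒜_k have no fixed coordinate after k, so
-- non-parallel ones already differ in their fixed coordinates before k.  It therefore
-- suffices to show 𝔼_c[m_H(x)²] ≤ ∏_{j<c} (1 + 3/((1-δ)|S_j|)) for every family H of
-- hyperplanes with pairwise different fixed coordinates among the first c, by induction
-- on c.  Passing from ℙ_c to ℙ_{c+1} reweights the fibre over x by factors that are at most
-- 1/(1-δ) and average to at most 1.  On that fibre, the members of H free at coordinate
-- c+1 contribute a count A independent of y, and those fixed there contribute k(y) ≤ M with
-- ∑_y k(y) ≤ M, where M counts them at x.  Hence the fibre average of m² is at most
-- A² + θ(A² + 2M²) with θ = 1/((1-δ)|S_{c+1}|), and both subfamilies again have pairwise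
-- different fixed coordinates among the first c.

open import Defs
open import Data.Nat using (ℕ; _≤_; _<_)
open import Data.Rational using (ℚ; 0ℚ; ½) renaming (_≤_ to _≤ℚ_)
open import Data.List using (List)
open import Data.List.Relation.Unary.All using (All)
open import Data.List.Relation.Unary.AllPairs using (AllPairs)
open import Relation.Nullary using (¬_)

open import Data.Bool as Bool using (Bool; true; false; not; T; _∧_; if_then_else_)
open import Data.Bool.ListAction using (any)
open import Data.Bool.Properties using (T-≡; T-not-≡; T-∧)
open import Data.Empty using (⊥-elim)
import Data.Integer as ℤ
import Data.Integer.Properties as ℤP
open import Data.List using ([]; _∷_; _++_; map; concatMap; filter; filterᵇ; length; upTo)
open import Data.List.Properties using (map-∘; length-upTo; length-filter; map-++; upTo-∷ʳ)
open import Data.List.Relation.Unary.All as All using ([]; _∷_)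
import Data.List.Relation.Unary.All.Properties as All
open import Data.List.Relation.Unary.AllPairs using ([]; _∷_)
import Data.List.Relation.Unary.AllPairs.Properties as AllPairs
open import Data.List.Relation.Unary.Unique.Propositional using (Unique)
import Data.List.Relation.Unary.Unique.Propositional.Properties as Unique
open import Data.Maybe using (just; nothing; is-just)
open import Data.Nat as ℕ using (zero; suc; NonZero; _≡ᵇ_)
import Data.Nat.Coprimality as Coprime
import Data.Nat.Properties as ℕ
open import Data.Product using (_,_; proj₁; proj₂)
open import Data.Rational as ℚ using (1ℚ; mkℚ; _+_; _*_; _-_; -_; 1/_; *≤*; positive; nonNegative; ≢-nonZero)
  renaming (_<_ to _<ℚ_)
open import Data.Rational.Properties
open import Data.Rational.Solver using (module +-*-Solver)
open import Data.Sum using (inj₁; inj₂)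
open import Function using (_∘_; case_of_; Equivalence)
open import Relation.Binary using (tri<; tri≈; tri>)
open import Relation.Binary.PropositionalEquality
open import Relation.Nullary using (Dec; yes; no)
open import Relation.Nullary.Decidable using (T?; toWitness)

∑ : {A : Set} → (A → ℚ) → List A → ℚ
∑ f xs = sumℚ (map f xs)

module _ {A : Set} where

  ∑-cong : ∀ {f g : A → ℚ} xs → (∀ x → f x ≡ g x) → ∑ f xs ≡ ∑ g xs
  ∑-cong []       f≡g = refl
  ∑-cong (x ∷ xs) f≡g = cong₂ _+_ (f≡g x) (∑-cong xs f≡g)

  ∑-mono-≤-All : ∀ {f g : A → ℚ} {xs} → All (λ x → f x ≤ℚ g x) xs → ∑ f xs ≤ℚ ∑ g xs
  ∑-mono-≤-All []         = ≤-refl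
  ∑-mono-≤-All (fx≤gx ∷ rest) = +-mono-≤ fx≤gx (∑-mono-≤-All rest)

  ∑-mono-≤ : ∀ {f g : A → ℚ} xs → (∀ x → f x ≤ℚ g x) → ∑ f xs ≤ℚ ∑ g xs
  ∑-mono-≤ xs f≤g = ∑-mono-≤-All (All.universal f≤g xs)

  ∑-zero : ∀ (xs : List A) → ∑ (λ _ → 0ℚ) xs ≡ 0ℚ
  ∑-zero []       = refl
  ∑-zero (x ∷ xs) = trans (+-identityˡ _) (∑-zero xs)

  ∑-nonNeg : ∀ {f : A → ℚ} xs → (∀ x → 0ℚ ≤ℚ f x) → 0ℚ ≤ℚ ∑ f xs
  ∑-nonNeg {f} xs 0≤f = subst (_≤ℚ ∑ f xs) (∑-zero xs) (∑-mono-≤ xs 0≤f)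

  ∑-+ : ∀ (f g : A → ℚ) xs → ∑ (λ x → f x + g x) xs ≡ ∑ f xs + ∑ g xs
  ∑-+ f g []       = refl
  ∑-+ f g (x ∷ xs) rewrite ∑-+ f g xs =
    solve 4 (λ a b c d → (a :+ b) :+ (c :+ d) := (a :+ c) :+ (b :+ d)) refl (f x) (g x) (∑ f xs) (∑ g xs)
    where open +-*-Solver

  ∑-*ˡ : ∀ k (f : A → ℚ) xs → ∑ (λ x → k * f x) xs ≡ k * ∑ f xs
  ∑-*ˡ k f []       = sym (*-zeroʳ k)
  ∑-*ˡ k f (x ∷ xs) rewrite ∑-*ˡ k f xs = sym (*-distribˡ-+ k (f x) (∑ f xs))

  ∑-*ʳ : ∀ k (f : A → ℚ) xs → ∑ (λ x → f x * k) xs ≡ ∑ f xs * k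
  ∑-*ʳ k f xs = begin
    ∑ (λ x → f x * k) xs ≡⟨ ∑-cong xs (λ x → *-comm (f x) k) ⟩
    ∑ (λ x → k * f x) xs ≡⟨ ∑-*ˡ k f xs ⟩
    k * ∑ f xs           ≡⟨ *-comm k (∑ f xs) ⟩
    ∑ f xs * k           ∎
    where open ≡-Reasoning

  ∑-++ : ∀ (f : A → ℚ) xs ys → ∑ f (xs ++ ys) ≡ ∑ f xs + ∑ f ys
  ∑-++ f []       ys = sym (+-identityˡ _)
  ∑-++ f (x ∷ xs) ys rewrite ∑-++ f xs ys = sym (+-assoc (f x) _ _)

  ∑-filterᵇ : ∀ (p : A → Bool) (f : A → ℚ) xs →
              ∑ f xs ≡ ∑ f (filterᵇ (not ∘ p) xs) + ∑ f (filterᵇ p xs)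
  ∑-filterᵇ p f []       = refl
  ∑-filterᵇ p f (x ∷ xs) with p x
  ... | true  rewrite ∑-filterᵇ p f xs =
    solve 3 (λ a b c → a :+ (b :+ c) := b :+ (a :+ c))
      refl (f x) (∑ f (filterᵇ (not ∘ p) xs)) (∑ f (filterᵇ p xs))
    where open +-*-Solver
  ... | false rewrite ∑-filterᵇ p f xs = sym (+-assoc (f x) _ _)

module _ {A B : Set} where

  ∑-map : ∀ (f : B → ℚ) (g : A → B) xs → ∑ f (map g xs) ≡ ∑ (λ x → f (g x)) xs
  ∑-map f g xs = cong sumℚ (sym (map-∘ xs))

  ∑-concatMap : ∀ (f : B → ℚ) (g : A → List B) xs → ∑ f (concatMap g xs) ≡ ∑ (λ x → ∑ f (g x)) xs
  ∑-concatMap f g []       = refl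
  ∑-concatMap f g (x ∷ xs) rewrite ∑-++ f (g x) (concatMap g xs) | ∑-concatMap f g xs = refl

  ∑-swap : ∀ (f : A → B → ℚ) xs ys →
           ∑ (λ y → ∑ (λ x → f x y) xs) ys ≡ ∑ (λ x → ∑ (f x) ys) xs
  ∑-swap f []       ys = ∑-zero ys
  ∑-swap f (x ∷ xs) ys rewrite ∑-+ (f x) (λ y → ∑ (λ x → f x y) xs) ys | ∑-swap f xs ys = refl


prodℚ-++ : ∀ xs ys → prodℚ (xs ++ ys) ≡ prodℚ xs * prodℚ ys
prodℚ-++ []       ys = sym (*-identityˡ (prodℚ ys))
prodℚ-++ (x ∷ xs) ys rewrite prodℚ-++ xs ys = sym (*-assoc x (prodℚ xs) (prodℚ ys))

ι : ℕ → ℚ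
ι n = ℤ.+ n ℚ./ 1

private
  ι≡mkℚ : ∀ n → ι n ≡ mkℚ (ℤ.+ n) 0 (Coprime.sym (Coprime.1-coprimeTo n))
  ι≡mkℚ n = ↥p/↧p≡p _

  frac1≡1/ι : ∀ d → frac 1 (suc d) ≡ 1/ (mkℚ (ℤ.+ suc d) 0 (Coprime.sym (Coprime.1-coprimeTo (suc d))))
  frac1≡1/ι d = ↥p/↧p≡p _

ι-+ : ∀ a b → ι (a ℕ.+ b) ≡ ι a + ι b
ι-+ a b rewrite ι≡mkℚ a | ι≡mkℚ b =
  /-cong (cong₂ ℤ._+_ (sym (ℤP.*-identityʳ (ℤ.+ a))) (sym (ℤP.*-identityʳ (ℤ.+ b)))) refl

ι-mono-≤ : ∀ {a b} → a ≤ b → ι a ≤ℚ ι b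
ι-mono-≤ {a} {b} a≤b rewrite ι≡mkℚ a | ι≡mkℚ b =
  *≤* (subst₂ ℤ._≤_ (sym (ℤP.*-identityʳ (ℤ.+ a))) (sym (ℤP.*-identityʳ (ℤ.+ b))) (ℤ.+≤+ a≤b))

0<ι : ∀ m .{{_ : NonZero m}} → 0ℚ <ℚ ι m
0<ι (suc d) = <-≤-trans (toWitness {a? = 0ℚ <? ι 1} _) (ι-mono-≤ {1} {suc d} (ℕ.s≤s ℕ.z≤n))

frac-nonNeg : ∀ a m → 0ℚ ≤ℚ frac a m
frac-nonNeg a zero    = ≤-refl
frac-nonNeg a (suc d) = nonNegative⁻¹ _ {{normalize-nonNeg a (suc d)}}

frac≡ι*frac1 : ∀ a m .{{_ : NonZero m}} → frac a m ≡ ι a * frac 1 m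
frac≡ι*frac1 a m@(suc d) rewrite ι≡mkℚ a | frac1≡1/ι d =
  /-cong (sym (ℤP.*-identityʳ (ℤ.+ a))) (sym (ℕ.+-identityʳ m))

ι*frac1≡1 : ∀ m .{{_ : NonZero m}} → ι m * frac 1 m ≡ 1ℚ
ι*frac1≡1 m@(suc d) rewrite ι≡mkℚ m | frac1≡1/ι d = *-inverseʳ (mkℚ (ℤ.+ m) 0 (Coprime.sym (Coprime.1-coprimeTo m)))

frac≤1 : ∀ {a m} → a ≤ m → frac a m ≤ℚ 1ℚ
frac≤1 {a} {zero}      _   = ≤ᵇ⇒≤ _
frac≤1 {a} {m@(suc _)} a≤m = begin
  frac a m         ≡⟨ frac≡ι*frac1 a m ⟩
  ι a * frac 1 m   ≤⟨ *-monoʳ-≤-nonNeg (frac 1 m) {{nonNegative (frac-nonNeg 1 m)}} (ι-mono-≤ a≤m) ⟩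
  ι m * frac 1 m   ≡⟨ ι*frac1≡1 m ⟩
  1ℚ               ∎
  where open ≤-Reasoning

module _ {p q : ℚ} where

  ≤∧≢⇒< : p ≤ℚ q → p ≢ q → p <ℚ q
  ≤∧≢⇒< p≤q p≢q with <-cmp p q
  ... | tri< p<q _ _ = p<q
  ... | tri≈ _ p≡q _ = ⊥-elim (p≢q p≡q)
  ... | tri> _ _ q<p = ⊥-elim (<-irrefl refl (<-≤-trans q<p p≤q))

  0<q-p : p <ℚ q → 0ℚ <ℚ q - p
  0<q-p p<q = subst (_<ℚ q - p) (+-inverseʳ p) (+-monoˡ-< (- p) p<q)

  0≤q-p : p ≤ℚ q → 0ℚ ≤ℚ q - p
  0≤q-p p≤q = subst (_≤ℚ q - p) (+-inverseʳ p) (+-monoˡ-≤ (- p) p≤q)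

  p-q≤0 : p ≤ℚ q → p - q ≤ℚ 0ℚ
  p-q≤0 p≤q = subst (p - q ≤ℚ_) (+-inverseʳ q) (+-monoˡ-≤ (- q) p≤q)

  p-q≤p : 0ℚ ≤ℚ q → p - q ≤ℚ p
  p-q≤p 0≤q = subst (p - q ≤ℚ_) (+-identityʳ p) (+-monoʳ-≤ p (neg-antimono-≤ 0≤q))

  0≤p*q : 0ℚ ≤ℚ p → 0ℚ ≤ℚ q → 0ℚ ≤ℚ p * q
  0≤p*q 0≤p 0≤q = nonNegative⁻¹ _ {{nonNeg*nonNeg⇒nonNeg p {{nonNegative 0≤p}} q {{nonNegative 0≤q}}}}

  0<p*q : 0ℚ <ℚ p → 0ℚ <ℚ q → 0ℚ <ℚ p * q
  0<p*q 0<p 0<q = positive⁻¹ _ {{pos*pos⇒pos p {{positive 0<p}} q {{positive 0<q}}}}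

module _ {r : ℚ} (0≤r : 0ℚ ≤ℚ r) {p q : ℚ} where

  *-monoˡ-≤-nonNeg′ : p ≤ℚ q → r * p ≤ℚ r * q
  *-monoˡ-≤-nonNeg′ = *-monoˡ-≤-nonNeg r {{nonNegative 0≤r}}

  *-monoʳ-≤-nonNeg′ : p ≤ℚ q → p * r ≤ℚ q * r
  *-monoʳ-≤-nonNeg′ = *-monoʳ-≤-nonNeg r {{nonNegative 0≤r}}

p*p≤q*q : ∀ {p q} → 0ℚ ≤ℚ p → p ≤ℚ q → p * p ≤ℚ q * q
p*p≤q*q 0≤p p≤q = ≤-trans (*-monoˡ-≤-nonNeg′ 0≤p p≤q) (*-monoʳ-≤-nonNeg′ (≤-trans 0≤p p≤q) p≤q)

0≤p*p : ∀ p → 0ℚ ≤ℚ p * p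
0≤p*p p with ≤-total 0ℚ p
... | inj₁ 0≤p = 0≤p*q 0≤p 0≤p
... | inj₂ p≤0 = subst (0ℚ ≤ℚ_) (solve 1 (λ p → (:- p) :* (:- p) := p :* p) refl p)
                   (0≤p*q (neg-antimono-≤ p≤0) (neg-antimono-≤ p≤0))
  where open +-*-Solver

p*q+p*q≤p*p+q*q : ∀ p q → p * q + p * q ≤ℚ p * p + q * q
p*q+p*q≤p*p+q*q p q = begin
  p * q + p * q
    ≡⟨ solve 2 (λ p q → p :* q :+ p :* q := (p :* p :+ q :* q) :- (p :- q) :* (p :- q)) refl p q ⟩
  (p * p + q * q) - (p - q) * (p - q)
    ≤⟨ p-q≤p (0≤p*p (p - q)) ⟩
  p * p + q * q ∎
  where
  open ≤-Reasoning
  open +-*-Solver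

*-cancelʳ-≡-pos : ∀ {p q} r → 0ℚ <ℚ r → p * r ≡ q * r → p ≡ q
*-cancelʳ-≡-pos r 0<r pr≡qr = ≤-antisym (*-cancelʳ-≤-pos r {{positive 0<r}} (≤-reflexive pr≡qr))
                                         (*-cancelʳ-≤-pos r {{positive 0<r}} (≤-reflexive (sym pr≡qr)))

div-*-cancelʳ : ∀ p q → q ≢ 0ℚ → div p q * q ≡ p
div-*-cancelʳ p q q≢0 with q ≟ 0ℚ
... | yes q≡0 = ⊥-elim (q≢0 q≡0)
... | no  q≢0 = begin
  p * 1/ q * q     ≡⟨ *-assoc p (1/ q) q ⟩
  p * (1/ q * q)   ≡⟨ cong (p *_) (*-inverseˡ q) ⟩
  p * 1ℚ           ≡⟨ *-identityʳ p ⟩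
  p                ∎
  where
  open ≡-Reasoning
  instance _ = ≢-nonZero q≢0

div-unique : ∀ {p q r} → q ≢ 0ℚ → r * q ≡ p → div p q ≡ r
div-unique {p} {q} {r} q≢0 rq≡p with q ≟ 0ℚ
... | yes q≡0 = ⊥-elim (q≢0 q≡0)
... | no  q≢0 = begin
  p * 1/ q         ≡⟨ cong (_* 1/ q) (sym rq≡p) ⟩
  r * q * 1/ q     ≡⟨ *-assoc r q (1/ q) ⟩
  r * (q * 1/ q)   ≡⟨ cong (r *_) (*-inverseʳ q) ⟩
  r * 1ℚ           ≡⟨ *-identityʳ r ⟩
  r                ∎
  where
  open ≡-Reasoning
  instance _ = ≢-nonZero q≢0

div≡*div1 : ∀ p q → div p q ≡ p * div 1ℚ q
div≡*div1 p q with q ≟ 0ℚ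
... | yes _   = sym (*-zeroʳ p)
... | no  q≢0 = cong (p *_) (sym (*-identityˡ (1/ q)))
  where instance _ = ≢-nonZero q≢0

div≤ : ∀ {p q r} → 0ℚ <ℚ q → p ≤ℚ r * q → div p q ≤ℚ r
div≤ {p} {q} {r} 0<q p≤rq = *-cancelʳ-≤-pos q {{positive 0<q}}
  (subst (_≤ℚ r * q) (sym (div-*-cancelʳ p q (≢-sym (<⇒≢ 0<q)))) p≤rq)

div-nonNeg : ∀ {p q} → 0ℚ ≤ℚ p → 0ℚ ≤ℚ q → 0ℚ ≤ℚ div p q
div-nonNeg {p} {q} 0≤p 0≤q with q ≟ 0ℚ
... | yes _   = ≤-refl
... | no  q≢0 = 0≤p*q 0≤p (<⇒≤ (positive⁻¹ _ {{1/pos⇒pos q {{positive 0<q}}}}))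
  where
  0<q = ≤∧≢⇒< 0≤q (≢-sym q≢0)
  instance _ = ≢-nonZero q≢0

𝟙 : Bool → ℚ
𝟙 true  = 1ℚ
𝟙 false = 0ℚ

0≤𝟙 : ∀ b → 0ℚ ≤ℚ 𝟙 b
0≤𝟙 true  = ≤ᵇ⇒≤ _
0≤𝟙 false = ≤-refl

𝟙-∧ : ∀ a b → 𝟙 (a ∧ b) ≡ 𝟙 a * 𝟙 b
𝟙-∧ true  b = sym (*-identityˡ (𝟙 b))
𝟙-∧ false b = sym (*-zeroˡ (𝟙 b))

𝟙-∧-≤ʳ : ∀ a b → 𝟙 (a ∧ b) ≤ℚ 𝟙 b
𝟙-∧-≤ʳ true  b = ≤-refl
𝟙-∧-≤ʳ false b = 0≤𝟙 b

module _ {A : Set} where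

  𝟙-any≤∑ : ∀ (p : A → Bool) xs → 𝟙 (any p xs) ≤ℚ ∑ (𝟙 ∘ p) xs
  𝟙-any≤∑ p []       = ≤-refl
  𝟙-any≤∑ p (x ∷ xs) with p x
  ... | true  = subst (_≤ℚ 1ℚ + ∑ (𝟙 ∘ p) xs) (+-identityʳ 1ℚ) (+-monoʳ-≤ 1ℚ (∑-nonNeg xs (0≤𝟙 ∘ p)))
  ... | false = subst (_≤ℚ 0ℚ + ∑ (𝟙 ∘ p) xs) (+-identityˡ _) (+-monoʳ-≤ 0ℚ (𝟙-any≤∑ p xs))

  ∑-𝟙-∧ : ∀ (p q : A → Bool) xs → ∑ (λ x → 𝟙 (p x ∧ q x)) xs ≡ ∑ (𝟙 ∘ q) (filterᵇ p xs)
  ∑-𝟙-∧ p q []       = refl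
  ∑-𝟙-∧ p q (x ∷ xs) with p x
  ... | true  = cong (𝟙 (q x) +_) (∑-𝟙-∧ p q xs)
  ... | false = trans (+-identityˡ _) (∑-𝟙-∧ p q xs)

  ι-count : ∀ (b : A → Bool) xs → ι (length (filter (λ x → b x Bool.≟ true) xs)) ≡ ∑ (𝟙 ∘ b) xs
  ι-count b []       = refl
  ι-count b (x ∷ xs) with b x
  ... | true  = trans (ι-+ 1 (length (filter (λ x → b x Bool.≟ true) xs))) (cong (1ℚ +_) (ι-count b xs))
  ... | false = trans (ι-count b xs) (sym (+-identityˡ _))

  ∑-if : ∀ (b : A → Bool) p q xs →
         ∑ (λ x → if b x then p else q) xs ≡ ∑ (𝟙 ∘ b) xs * p + (ι (length xs) - ∑ (𝟙 ∘ b) xs) * q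
  ∑-if b p q [] = solve 2 (λ p q → con 0ℚ := con 0ℚ :* p :+ (con 0ℚ :- con 0ℚ) :* q) refl p q
    where open +-*-Solver
  ∑-if b p q (x ∷ xs) with b x
  ... | true  rewrite ∑-if b p q xs | ι-+ 1 (length xs) =
    solve 4 (λ p q n l → p :+ (n :* p :+ (l :- n) :* q) := (con 1ℚ :+ n) :* p :+ ((con 1ℚ :+ l) :- (con 1ℚ :+ n)) :* q)
      refl p q (∑ (𝟙 ∘ b) xs) (ι (length xs))
    where open +-*-Solver
  ... | false rewrite ∑-if b p q xs | ι-+ 1 (length xs) =
    solve 4 (λ p q n l → q :+ (n :* p :+ (l :- n) :* q) := (con 0ℚ :+ n) :* p :+ ((con 1ℚ :+ l) :- (con 0ℚ :+ n)) :* q)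
      refl p q (∑ (𝟙 ∘ b) xs) (ι (length xs))
    where open +-*-Solver

∑-𝟙-≡ᵇ-absent : ∀ z {ys} → All (z ≢_) ys → ∑ (λ y → 𝟙 (z ≡ᵇ y)) ys ≡ 0ℚ
∑-𝟙-≡ᵇ-absent z []                  = refl
∑-𝟙-≡ᵇ-absent z {y ∷ ys} (z≢y ∷ z∉ys) with z ≡ᵇ y in z≡ᵇy
... | true  = ⊥-elim (z≢y (ℕ.≡ᵇ⇒≡ z y (subst T (sym z≡ᵇy) _)))
... | false = trans (+-identityˡ _) (∑-𝟙-≡ᵇ-absent z z∉ys)

∑-𝟙-≡ᵇ≤1 : ∀ z {ys} → Unique ys → ∑ (λ y → 𝟙 (z ≡ᵇ y)) ys ≤ℚ 1ℚ
∑-𝟙-≡ᵇ≤1 z []                        = ≤ᵇ⇒≤ _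
∑-𝟙-≡ᵇ≤1 z {y ∷ ys} (y∉ys ∷ unique) with z ≡ᵇ y in z≡ᵇy
... | true  = ≤-reflexive (trans (cong (1ℚ +_) (∑-𝟙-≡ᵇ-absent z z∉ys)) (+-identityʳ 1ℚ))
  where z∉ys = subst (λ w → All (w ≢_) ys) (sym (ℕ.≡ᵇ⇒≡ z y (subst T (sym z≡ᵇy) _))) y∉ys
... | false = subst (_≤ℚ 1ℚ) (sym (+-identityˡ _)) (∑-𝟙-≡ᵇ≤1 z unique)

∑-𝟙-≡ᵇ-∧≤ : ∀ z b {ys} → Unique ys → ∑ (λ y → 𝟙 ((z ≡ᵇ y) ∧ b)) ys ≤ℚ 𝟙 b
∑-𝟙-≡ᵇ-∧≤ z b {ys} unique = begin
  ∑ (λ y → 𝟙 ((z ≡ᵇ y) ∧ b)) ys   ≡⟨ ∑-cong ys (λ y → 𝟙-∧ (z ≡ᵇ y) b) ⟩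
  ∑ (λ y → 𝟙 (z ≡ᵇ y) * 𝟙 b) ys   ≡⟨ ∑-*ʳ (𝟙 b) (λ y → 𝟙 (z ≡ᵇ y)) ys ⟩
  ∑ (λ y → 𝟙 (z ≡ᵇ y)) ys * 𝟙 b   ≤⟨ *-monoʳ-≤-nonNeg′ (0≤𝟙 b) (∑-𝟙-≡ᵇ≤1 z unique) ⟩
  1ℚ * 𝟙 b                         ≡⟨ *-identityˡ (𝟙 b) ⟩
  𝟙 b                              ∎
  where open ≤-Reasoning

module _ {A : Set} (xs : List A) (w k : A → ℚ) {a m t : ℚ}
         (w≤t : ∀ x → w x ≤ℚ t) (∑w≤1 : ∑ w xs ≤ℚ 1ℚ)
         (0≤k : ∀ x → 0ℚ ≤ℚ k x) (k≤m : ∀ x → k x ≤ℚ m) (∑k≤m : ∑ k xs ≤ℚ m)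
         (0≤a : 0ℚ ≤ℚ a) (0≤t : 0ℚ ≤ℚ t) where

  private
    0≤m : 0ℚ ≤ℚ m
    0≤m = ≤-trans (∑-nonNeg xs 0≤k) ∑k≤m

    0≤c : 0ℚ ≤ℚ t * (a + a + m)
    0≤c = 0≤p*q 0≤t (+-mono-≤ (+-mono-≤ 0≤a 0≤a) 0≤m)

    -- k² ≤ m k, so the cross and square terms are linear in k.
    pointwise : ∀ x → w x * ((a + k x) * (a + k x)) ≤ℚ a * a * w x + t * (a + a + m) * k x
    pointwise x = begin
      w x * ((a + k x) * (a + k x))
        ≡⟨ solve 3 (λ w a k → w :* ((a :+ k) :* (a :+ k)) := a :* a :* w :+ w :* (a :* k :+ a :* k :+ k :* k))
                   refl (w x) a (k x) ⟩
      a * a * w x + w x * (a * k x + a * k x + k x * k x)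
        ≤⟨ +-monoʳ-≤ (a * a * w x) (*-monoʳ-≤-nonNeg′ 0≤cross (w≤t x)) ⟩
      a * a * w x + t * (a * k x + a * k x + k x * k x)
        ≤⟨ +-monoʳ-≤ (a * a * w x) (*-monoˡ-≤-nonNeg′ 0≤t
             (+-monoʳ-≤ (a * k x + a * k x) (*-monoʳ-≤-nonNeg′ (0≤k x) (k≤m x)))) ⟩
      a * a * w x + t * (a * k x + a * k x + m * k x)
        ≡⟨ solve 5 (λ a w t k m → a :* a :* w :+ t :* (a :* k :+ a :* k :+ m :* k)
                                := a :* a :* w :+ t :* (a :+ a :+ m) :* k)
                   refl a (w x) t (k x) m ⟩
      a * a * w x + t * (a + a + m) * k x ∎
      where
      open ≤-Reasoning
      open +-*-Solver
      0≤cross : 0ℚ ≤ℚ a * k x + a * k x + k x * k x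
      0≤cross = +-mono-≤ (+-mono-≤ (0≤p*q 0≤a (0≤k x)) (0≤p*q 0≤a (0≤k x))) (0≤p*q (0≤k x) (0≤k x))

  ∑-weighted-shifted-square≤ : ∑ (λ x → w x * ((a + k x) * (a + k x))) xs ≤ℚ a * a + t * (a * a + m * m + m * m)
  ∑-weighted-shifted-square≤ = begin
    ∑ (λ x → w x * ((a + k x) * (a + k x))) xs
      ≤⟨ ∑-mono-≤ xs pointwise ⟩
    ∑ (λ x → a * a * w x + t * (a + a + m) * k x) xs
      ≡⟨ trans (∑-+ (λ x → a * a * w x) (λ x → t * (a + a + m) * k x) xs)
               (cong₂ _+_ (∑-*ˡ (a * a) w xs) (∑-*ˡ (t * (a + a + m)) k xs)) ⟩
    a * a * ∑ w xs + t * (a + a + m) * ∑ k xs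
      ≤⟨ +-mono-≤ (*-monoˡ-≤-nonNeg′ (0≤p*p a) ∑w≤1) (*-monoˡ-≤-nonNeg′ 0≤c ∑k≤m) ⟩
    a * a * 1ℚ + t * (a + a + m) * m
      ≡⟨ solve 3 (λ a m t → a :* a :* con 1ℚ :+ t :* (a :+ a :+ m) :* m
                          := a :* a :+ t :* ((a :* m :+ a :* m) :+ m :* m))
                 refl a m t ⟩
    a * a + t * ((a * m + a * m) + m * m)
      ≤⟨ +-monoʳ-≤ (a * a) (*-monoˡ-≤-nonNeg′ 0≤t (+-monoˡ-≤ (m * m) (p*q+p*q≤p*p+q*q a m))) ⟩
    a * a + t * (a * a + m * m + m * m) ∎
    where
    open ≤-Reasoning
    open +-*-Solver

module _ {A : Set} {P : A → Set} {R S : A → A → Set} where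

  AllPairs-map-All : (∀ {x y} → P x → P y → R x y → S x y) →
                     ∀ {xs} → All P xs → AllPairs R xs → AllPairs S xs
  AllPairs-map-All f []         []         = []
  AllPairs-map-All f (px ∷ pxs) (rxs ∷ rs) =
    All.zipWith (λ (py , rxy) → f px py rxy) (pxs , rxs) ∷ AllPairs-map-All f pxs rs

-- Hyperplanes through a point

module Hyperplanes (n : ℕ) (s : ℕ → ℕ) (δ : ℚ) (𝒜 : List Hyp) where
  open Setup n s δ 𝒜

  incidences : List Hyp → List ℕ → ℚ
  incidences H x = ∑ (λ h → 𝟙 (matches h x)) H

  freeAt fixedAt level : ℕ → List Hyp → List Hyp
  freeAt  c = filterᵇ (λ h → not (fixed h c))
  fixedAt c = filterᵇ (λ h → fixed h c)
  level   c = filterᵇ (λ h → inLevel h c)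

  AgreeBelow : ℕ → Hyp → Hyp → Set
  AgreeBelow c h h′ = ∀ j → j < c → fixed h j ≡ fixed h′ j

  Separated : ℕ → List Hyp → Set
  Separated c = AllPairs (λ h h′ → ¬ AgreeBelow c h h′)

  incidences-split : ∀ c H x → incidences H x ≡ incidences (freeAt c H) x + incidences (fixedAt c H) x
  incidences-split c H x = ∑-filterᵇ (λ h → fixed h c) (λ h → 𝟙 (matches h x)) H

  incidences-∷≤ : ∀ H y x → incidences H (y ∷ x) ≤ℚ incidences H x
  incidences-∷≤ H y x = ∑-mono-≤ H (λ h → 𝟙-∧-≤ʳ (okAt h (length x) y) (matches h x))

  matches-∷-free : ∀ h y x → T (not (fixed h (length x))) → matches h (y ∷ x) ≡ matches h x
  matches-∷-free h y x free with h (length x)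
  ... | nothing = refl
  ... | just _  = ⊥-elim free

  incidences-∷-free : ∀ H y x → All (λ h → T (not (fixed h (length x)))) H →
                      incidences H (y ∷ x) ≡ incidences H x
  incidences-∷-free []      y x []            = refl
  incidences-∷-free (h ∷ H) y x (free ∷ frees) =
    cong₂ (λ b r → 𝟙 b + r) (matches-∷-free h y x free) (incidences-∷-free H y x frees)

  ∑-matches-∷-fixed≤ : ∀ h x {ys} → T (fixed h (length x)) → Unique ys →
                       ∑ (λ y → 𝟙 (matches h (y ∷ x))) ys ≤ℚ 𝟙 (matches h x)
  ∑-matches-∷-fixed≤ h x fixedAtx unique with h (length x)
  ... | just z  = ∑-𝟙-≡ᵇ-∧≤ z (matches h x) unique
  ... | nothing = ⊥-elim fixedAtx

  ∑-incidences-∷-fixed≤ : ∀ H x m → All (λ h → T (fixed h (length x))) H →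
                          ∑ (λ y → incidences H (y ∷ x)) (upTo m) ≤ℚ incidences H x
  ∑-incidences-∷-fixed≤ H x m fixeds = begin
    ∑ (λ y → incidences H (y ∷ x)) (upTo m)
      ≡⟨ ∑-swap (λ h y → 𝟙 (matches h (y ∷ x))) H (upTo m) ⟩
    ∑ (λ h → ∑ (λ y → 𝟙 (matches h (y ∷ x))) (upTo m)) H
      ≤⟨ ∑-mono-≤-All (All.map (λ fixedAtx → ∑-matches-∷-fixed≤ _ x fixedAtx (Unique.upTo⁺ m)) fixeds) ⟩
    incidences H x ∎
    where open ≤-Reasoning

  Separated-suc⇒Separated-filterᵇ :
    ∀ c (p : Hyp → Bool) → (∀ {h h′} → T (p h) → T (p h′) → fixed h c ≡ fixed h′ c) →
    ∀ {H} → Separated (suc c) H → Separated c (filterᵇ p H)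
  Separated-suc⇒Separated-filterᵇ c p sameFixedness {H} separated =
    AllPairs-map-All extend (All.all-filter (T? ∘ p) H) (AllPairs.filter⁺ (T? ∘ p) separated)
    where
    extend : ∀ {h h′} → T (p h) → T (p h′) → ¬ AgreeBelow (suc c) h h′ → ¬ AgreeBelow c h h′
    extend ph ph′ disagree agree = disagree λ j j<1+c → case ℕ.m<1+n⇒m<n∨m≡n j<1+c of λ where
      (inj₁ j<c)  → agree j j<c
      (inj₂ refl) → sameFixedness ph ph′

  freeAt-separated : ∀ c {H} → Separated (suc c) H → Separated c (freeAt c H)
  freeAt-separated c = Separated-suc⇒Separated-filterᵇ c (λ h → not (fixed h c))
    λ free free′ → trans (Equivalence.to T-not-≡ free) (sym (Equivalence.to T-not-≡ free′))

  fixedAt-separated : ∀ c {H} → Separated (suc c) H → Separated c (fixedAt c H)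
  fixedAt-separated c = Separated-suc⇒Separated-filterᵇ c (λ h → fixed h c)
    λ fixd fixd′ → trans (Equivalence.to T-≡ fixd) (sym (Equivalence.to T-≡ fixd′))

  inLevel⇒fixed : ∀ h c → T (inLevel h c) → T (fixed h c)
  inLevel⇒fixed h c = proj₁ ∘ Equivalence.to T-∧

  inLevel⇒free-above : ∀ {h c i} → WellFormed n s h → T (inLevel h c) → c < i → fixed h i ≡ false
  inLevel⇒free-above {h} {c} {i} wf lvl c<i with h i in hi≡
  ... | nothing = refl
  ... | just y  = ⊥-elim (subst (T ∘ not ∘ is-just) hi≡ (subst (λ k → T (not (fixed h k))) (ℕ.m+[n∸m]≡n c<i) free))
    where
    i<n = proj₁ (wf i y hi≡)
    free : T (not (fixed h (suc c ℕ.+ (i ℕ.∸ suc c))))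
    free = All.applyUpTo⁻ (λ k → k) (n ℕ.∸ suc c)
             (All.all⁺ (λ k → not (fixed h (suc c ℕ.+ k))) (upTo (n ℕ.∸ suc c)) (proj₂ (Equivalence.to T-∧ lvl)))
             (ℕ.∸-monoˡ-< i<n c<i)

  level-parallel : ∀ {c h h′} → WellFormed n s h → WellFormed n s h′ →
                   T (inLevel h c) → T (inLevel h′ c) → AgreeBelow c h h′ → Parallel h h′
  level-parallel {c} {h} {h′} wf wf′ lvl lvl′ agree i with ℕ.<-cmp i c
  ... | tri< i<c _ _    = agree i i<c
  ... | tri≈ _ refl _   = trans (Equivalence.to T-≡ (inLevel⇒fixed h c lvl))
                                (sym (Equivalence.to T-≡ (inLevel⇒fixed h′ c lvl′)))
  ... | tri> _ _ c<i    = trans (inLevel⇒free-above wf lvl c<i) (sym (inLevel⇒free-above wf′ lvl′ c<i))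

  level-separated : ∀ c {H} → All (WellFormed n s) H → AllPairs (λ h h′ → ¬ Parallel h h′) H →
                    Separated c (level c H)
  level-separated c {H} wfs nonParallel =
    AllPairs-map-All (λ (wf , lvl) (wf′ , lvl′) notParallel agree → notParallel (level-parallel wf wf′ lvl lvl′ agree))
      (All.zip (All.filter⁺ (T? ∘ (λ h → inLevel h c)) wfs , All.all-filter (T? ∘ (λ h → inLevel h c)) H))
      (AllPairs.filter⁺ (T? ∘ (λ h → inLevel h c)) nonParallel)

  pts-length : ∀ c → All (λ x → length x ≡ c) (pts c)
  pts-length zero    = refl ∷ []
  pts-length (suc c) = All.concat⁺ (All.map⁺ (All.map
    (λ len≡c → All.map⁺ (All.universal (λ _ → cong suc len≡c) (upTo (s c)))) (pts-length c)))

  ∑-pts-suc : ∀ c (f : List ℕ → ℚ) → ∑ f (pts (suc c)) ≡ ∑ (λ x → ∑ (λ y → f (y ∷ x)) (upTo (s c))) (pts c)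
  ∑-pts-suc c f = trans (∑-concatMap f (λ x → map (_∷ x) (upTo (s c))) (pts c))
                        (∑-cong (pts c) (λ x → ∑-map f (_∷ x) (upTo (s c))))

  α≡ : ∀ c x .{{_ : NonZero (s c)}} → α c x ≡ ∑ (λ y → 𝟙 (inB c (y ∷ x))) (upTo (s c)) * frac 1 (s c)
  α≡ c x = trans (frac≡ι*frac1 _ (s c)) (cong (_* frac 1 (s c)) (ι-count (λ y → inB c (y ∷ x)) (upTo (s c))))

  𝟙-inB≤incidences-level : ∀ c p → 𝟙 (inB c p) ≤ℚ incidences (level c 𝒜) p
  𝟙-inB≤incidences-level c p = ≤-trans (𝟙-any≤∑ (λ h → inLevel h c ∧ matches h p) 𝒜)
                                       (≤-reflexive (∑-𝟙-∧ (λ h → inLevel h c) (λ h → matches h p) 𝒜))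

  α≤incidences-level : ∀ c x → length x ≡ c → .{{_ : NonZero (s c)}} →
                       α c x ≤ℚ incidences (level c 𝒜) x * frac 1 (s c)
  α≤incidences-level c x refl = begin
    α c x
      ≡⟨ α≡ c x ⟩
    ∑ (λ y → 𝟙 (inB c (y ∷ x))) (upTo (s c)) * u
      ≤⟨ *-monoʳ-≤-nonNeg′ (frac-nonNeg 1 (s c)) (begin
           ∑ (λ y → 𝟙 (inB c (y ∷ x))) (upTo (s c))
             ≤⟨ ∑-mono-≤ (upTo (s c)) (λ y → 𝟙-inB≤incidences-level c (y ∷ x)) ⟩
           ∑ (λ y → incidences (level c 𝒜) (y ∷ x)) (upTo (s c))
             ≤⟨ ∑-incidences-∷-fixed≤ (level c 𝒜) x (s c) levelFixed ⟩
           incidences (level c 𝒜) x ∎) ⟩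
    incidences (level c 𝒜) x * u ∎
    where
    open ≤-Reasoning
    u = frac 1 (s c)
    levelFixed : All (λ h → T (fixed h c)) (level c 𝒜)
    levelFixed = All.map (λ {h} → inLevel⇒fixed h c) (All.all-filter (T? ∘ (λ h → inLevel h c)) 𝒜)

-- The reweighted measures

module Reweighted (n : ℕ) (s : ℕ → ℕ) (δ : ℚ) (𝒜 : List Hyp) (0≤δ : 0ℚ ≤ℚ δ) (δ≤½ : δ ≤ℚ ½) where
  open Setup n s δ 𝒜
  open Hyperplanes n s δ 𝒜

  δ<1 : δ <ℚ 1ℚ
  δ<1 = ≤-<-trans δ≤½ (toWitness {a? = ½ <? 1ℚ} _)

  0<1-δ : 0ℚ <ℚ 1ℚ - δ
  0<1-δ = 0<q-p δ<1

  maxFactor : ℚ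
  maxFactor = div 1ℚ (1ℚ - δ)

  maxFactor*[1-δ]≡1 : maxFactor * (1ℚ - δ) ≡ 1ℚ
  maxFactor*[1-δ]≡1 = div-*-cancelʳ 1ℚ (1ℚ - δ) (≢-sym (<⇒≢ 0<1-δ))

  0≤maxFactor : 0ℚ ≤ℚ maxFactor
  0≤maxFactor = div-nonNeg (≤ᵇ⇒≤ _) (<⇒≤ 0<1-δ)

  0≤factorIn : ∀ a → 0ℚ ≤ℚ factorIn a
  0≤factorIn a = p≤p⊔q 0ℚ (div (a - δ) (a * (1ℚ - δ)))

  0≤factorOut : ∀ {a} → a ≤ℚ 1ℚ → 0ℚ ≤ℚ factorOut a
  0≤factorOut a≤1 = ⊓-glb (div-nonNeg (≤ᵇ⇒≤ _) (0≤q-p a≤1)) 0≤maxFactor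

  factorOut≤maxFactor : ∀ a → factorOut a ≤ℚ maxFactor
  factorOut≤maxFactor a = p⊓q≤q (div 1ℚ (1ℚ - a)) maxFactor

  a*maxFactor*[1-δ]≡a : ∀ a → a * maxFactor * (1ℚ - δ) ≡ a
  a*maxFactor*[1-δ]≡a a = trans (*-assoc a maxFactor (1ℚ - δ)) (trans (cong (a *_) maxFactor*[1-δ]≡1) (*-identityʳ a))

  factorIn≤maxFactor : ∀ {a} → 0ℚ ≤ℚ a → factorIn a ≤ℚ maxFactor
  factorIn≤maxFactor {a} 0≤a = ⊔-lub 0≤maxFactor (bounded (a ≟ 0ℚ))
    where
    bounded : Dec (a ≡ 0ℚ) → div (a - δ) (a * (1ℚ - δ)) ≤ℚ maxFactor
    bounded (yes refl) = subst (λ q → div (0ℚ - δ) q ≤ℚ maxFactor) (sym (*-zeroˡ (1ℚ - δ))) 0≤maxFactor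
    bounded (no a≢0)   = div≤ (0<p*q (≤∧≢⇒< 0≤a (≢-sym a≢0)) 0<1-δ) (begin
      a - δ                          ≤⟨ p-q≤p 0≤δ ⟩
      a                              ≡⟨ sym (a*maxFactor*[1-δ]≡a a) ⟩
      a * maxFactor * (1ℚ - δ)       ≡⟨ solve 3 (λ a d e → a :* d :* e := d :* (a :* e)) refl a maxFactor (1ℚ - δ) ⟩
      maxFactor * (a * (1ℚ - δ))     ∎)
      where
      open ≤-Reasoning
      open +-*-Solver

  a*factorIn≡0 : ∀ {a} → 0ℚ ≤ℚ a → a ≤ℚ δ → a * factorIn a ≡ 0ℚ
  a*factorIn≡0 {a} 0≤a a≤δ with a ≟ 0ℚ
  ... | yes refl = *-zeroˡ (factorIn 0ℚ)
  ... | no  a≢0  = trans (cong (a *_) (p≥q⇒p⊔q≡p negative)) (*-zeroʳ a)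
    where
    negative : div (a - δ) (a * (1ℚ - δ)) ≤ℚ 0ℚ
    negative = div≤ (0<p*q (≤∧≢⇒< 0≤a (≢-sym a≢0)) 0<1-δ)
                    (subst (a - δ ≤ℚ_) (sym (*-zeroˡ (a * (1ℚ - δ)))) (p-q≤0 a≤δ))

  a*factorIn≡[a-δ]*maxFactor : ∀ {a} → δ <ℚ a → a * factorIn a ≡ (a - δ) * maxFactor
  a*factorIn≡[a-δ]*maxFactor {a} δ<a = *-cancelʳ-≡-pos (1ℚ - δ) 0<1-δ (begin
    a * factorIn a * (1ℚ - δ)          ≡⟨ cong (λ f → a * f * (1ℚ - δ)) factorIn≡q ⟩
    a * q * (1ℚ - δ)                   ≡⟨ solve 3 (λ a q e → a :* q :* e := q :* (a :* e)) refl a q (1ℚ - δ) ⟩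
    q * (a * (1ℚ - δ))                 ≡⟨ div-*-cancelʳ (a - δ) (a * (1ℚ - δ)) (≢-sym (<⇒≢ 0<a[1-δ])) ⟩
    a - δ                              ≡⟨ sym (a*maxFactor*[1-δ]≡a (a - δ)) ⟩
    (a - δ) * maxFactor * (1ℚ - δ)     ∎)
    where
    open ≡-Reasoning
    open +-*-Solver
    q = div (a - δ) (a * (1ℚ - δ))
    0<a[1-δ] = 0<p*q (≤-<-trans 0≤δ δ<a) 0<1-δ
    factorIn≡q : factorIn a ≡ q
    factorIn≡q = p≤q⇒p⊔q≡q (div-nonNeg (0≤q-p (<⇒≤ δ<a)) (<⇒≤ 0<a[1-δ]))

  [1-a]*factorOut≤1 : ∀ {a} → a <ℚ 1ℚ → (1ℚ - a) * factorOut a ≤ℚ 1ℚ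
  [1-a]*factorOut≤1 {a} a<1 = begin
    (1ℚ - a) * factorOut a       ≤⟨ *-monoˡ-≤-nonNeg′ (<⇒≤ (0<q-p a<1)) (p⊓q≤p (div 1ℚ (1ℚ - a)) maxFactor) ⟩
    (1ℚ - a) * div 1ℚ (1ℚ - a)   ≡⟨ *-comm (1ℚ - a) (div 1ℚ (1ℚ - a)) ⟩
    div 1ℚ (1ℚ - a) * (1ℚ - a)   ≡⟨ div-*-cancelʳ 1ℚ (1ℚ - a) (≢-sym (<⇒≢ (0<q-p a<1))) ⟩
    1ℚ                           ∎
    where open ≤-Reasoning

  factor-average≤1 : ∀ {a} → 0ℚ ≤ℚ a → a ≤ℚ 1ℚ → a * factorIn a + (1ℚ - a) * factorOut a ≤ℚ 1ℚ
  factor-average≤1 {a} 0≤a a≤1 with a ≤? δ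
  ... | yes a≤δ = begin
    a * factorIn a + (1ℚ - a) * factorOut a   ≡⟨ cong (_+ (1ℚ - a) * factorOut a) (a*factorIn≡0 0≤a a≤δ) ⟩
    0ℚ + (1ℚ - a) * factorOut a               ≡⟨ +-identityˡ _ ⟩
    (1ℚ - a) * factorOut a                    ≤⟨ [1-a]*factorOut≤1 (≤-<-trans a≤δ δ<1) ⟩
    1ℚ                                        ∎
    where open ≤-Reasoning
  ... | no  a≰δ = begin
    a * factorIn a + (1ℚ - a) * factorOut a
      ≤⟨ +-monoʳ-≤ (a * factorIn a) (*-monoˡ-≤-nonNeg′ (0≤q-p a≤1) (factorOut≤maxFactor a)) ⟩
    a * factorIn a + (1ℚ - a) * maxFactor
      ≡⟨ cong (_+ (1ℚ - a) * maxFactor) (a*factorIn≡[a-δ]*maxFactor (≰⇒> a≰δ)) ⟩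
    (a - δ) * maxFactor + (1ℚ - a) * maxFactor
      ≡⟨ solve 3 (λ a d m → (a :- d) :* m :+ (con 1ℚ :- a) :* m := m :* (con 1ℚ :- d)) refl a δ maxFactor ⟩
    maxFactor * (1ℚ - δ)
      ≡⟨ maxFactor*[1-δ]≡1 ⟩
    1ℚ ∎
    where
    open ≤-Reasoning
    open +-*-Solver

  0≤α : ∀ c x → 0ℚ ≤ℚ α c x
  0≤α c x = frac-nonNeg _ (s c)

  α≤1 : ∀ c x → α c x ≤ℚ 1ℚ
  α≤1 c x = frac≤1 (subst (length (filter inB? (upTo (s c))) ≤_) (length-upTo (s c)) (length-filter inB? (upTo (s c))))
    where inB? = λ y → inB c (y ∷ x) Bool.≟ true

  reweight : ℕ → List ℕ → ℕ → ℚ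
  reweight c x y = if inB c (y ∷ x) then factorIn (α c x) else factorOut (α c x)

  0≤reweight : ∀ c x y → 0ℚ ≤ℚ reweight c x y
  0≤reweight c x y with inB c (y ∷ x)
  ... | true  = 0≤factorIn (α c x)
  ... | false = 0≤factorOut (α≤1 c x)

  reweight≤maxFactor : ∀ c x y → reweight c x y ≤ℚ maxFactor
  reweight≤maxFactor c x y with inB c (y ∷ x)
  ... | true  = factorIn≤maxFactor (0≤α c x)
  ... | false = factorOut≤maxFactor (α c x)

  0≤ℙ : ∀ c x → 0ℚ ≤ℚ ℙ c x
  0≤ℙ zero    []      = ≤ᵇ⇒≤ _
  0≤ℙ zero    (_ ∷ _) = ≤-refl
  0≤ℙ (suc c) []      = ≤-refl
  0≤ℙ (suc c) (y ∷ x) = 0≤p*q (0≤p*q (0≤reweight c x y) (0≤ℙ c x)) (frac-nonNeg 1 (s c))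

  ∑-weight≤1 : ∀ c x .{{_ : NonZero (s c)}} → ∑ (λ y → reweight c x y * frac 1 (s c)) (upTo (s c)) ≤ℚ 1ℚ
  ∑-weight≤1 c x = begin
    ∑ (λ y → reweight c x y * u) (upTo (s c))
      ≡⟨ ∑-*ʳ u (reweight c x) (upTo (s c)) ⟩
    ∑ (reweight c x) (upTo (s c)) * u
      ≡⟨ cong (_* u) (∑-if (λ y → inB c (y ∷ x)) (factorIn a) (factorOut a) (upTo (s c))) ⟩
    (N * factorIn a + (ι (length (upTo (s c))) - N) * factorOut a) * u
      ≡⟨ cong (λ l → (N * factorIn a + (ι l - N) * factorOut a) * u) (length-upTo (s c)) ⟩
    (N * factorIn a + (ι (s c) - N) * factorOut a) * u
      ≡⟨ solve 5 (λ N i o m u → (N :* i :+ (m :- N) :* o) :* u := (N :* u) :* i :+ (m :* u :- N :* u) :* o)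
                 refl N (factorIn a) (factorOut a) (ι (s c)) u ⟩
    (N * u) * factorIn a + (ι (s c) * u - N * u) * factorOut a
      ≡⟨ cong₂ (λ a′ one → a′ * factorIn a + (one - a′) * factorOut a) (sym (α≡ c x)) (ι*frac1≡1 (s c)) ⟩
    a * factorIn a + (1ℚ - a) * factorOut a
      ≤⟨ factor-average≤1 (0≤α c x) (α≤1 c x) ⟩
    1ℚ ∎
    where
    open ≤-Reasoning
    open +-*-Solver
    u = frac 1 (s c)
    a = α c x
    N = ∑ (λ y → 𝟙 (inB c (y ∷ x))) (upTo (s c))

  θ : ℕ → ℚ
  θ c = div 1ℚ ((1ℚ - δ) * ι (s c))

  0≤θ : ∀ c → 0ℚ ≤ℚ θ c
  0≤θ c = div-nonNeg (≤ᵇ⇒≤ _) (0≤p*q (<⇒≤ 0<1-δ) (frac-nonNeg (s c) 1))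

  maxFactor*frac1≡θ : ∀ c .{{_ : NonZero (s c)}} → maxFactor * frac 1 (s c) ≡ θ c
  maxFactor*frac1≡θ c = sym (div-unique (≢-sym (<⇒≢ (0<p*q 0<1-δ (0<ι (s c))))) (begin
    maxFactor * frac 1 (s c) * ((1ℚ - δ) * ι (s c))
      ≡⟨ solve 4 (λ m u e i → m :* u :* (e :* i) := (m :* e) :* (i :* u))
                 refl maxFactor (frac 1 (s c)) (1ℚ - δ) (ι (s c)) ⟩
    maxFactor * (1ℚ - δ) * (ι (s c) * frac 1 (s c))
      ≡⟨ cong₂ _*_ maxFactor*[1-δ]≡1 (ι*frac1≡1 (s c)) ⟩
    1ℚ * 1ℚ ∎))
    where
    open ≡-Reasoning
    open +-*-Solver

  weight≤θ : ∀ c x y .{{_ : NonZero (s c)}} → reweight c x y * frac 1 (s c) ≤ℚ θ c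
  weight≤θ c x y = subst (reweight c x y * frac 1 (s c) ≤ℚ_) (maxFactor*frac1≡θ c)
                         (*-monoʳ-≤-nonNeg′ (frac-nonNeg 1 (s c)) (reweight≤maxFactor c x y))

  growth : ℕ → ℚ
  growth j = 1ℚ + div (ι 3) ((1ℚ - δ) * ι (s j))

  Π : ℕ → ℚ
  Π c = prodℚ (map growth (upTo c))

  Π-suc : ∀ c → Π (suc c) ≡ Π c * (1ℚ + ι 3 * θ c)
  Π-suc c = begin
    prodℚ (map growth (upTo (suc c)))            ≡⟨ cong (prodℚ ∘ map growth) (sym (upTo-∷ʳ c)) ⟩
    prodℚ (map growth (upTo c ++ c ∷ []))        ≡⟨ cong prodℚ (map-++ growth (upTo c) (c ∷ [])) ⟩
    prodℚ (map growth (upTo c) ++ growth c ∷ []) ≡⟨ prodℚ-++ (map growth (upTo c)) (growth c ∷ []) ⟩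
    Π c * (growth c * 1ℚ)                        ≡⟨ cong (Π c *_) (*-identityʳ (growth c)) ⟩
    Π c * growth c                               ≡⟨ cong (λ g → Π c * (1ℚ + g)) (div≡*div1 (ι 3) ((1ℚ - δ) * ι (s c))) ⟩
    Π c * (1ℚ + ι 3 * θ c)                       ∎
    where open ≡-Reasoning

  secondMoment : ℕ → List Hyp → ℚ
  secondMoment c H = ∑ (λ x → incidences H x * incidences H x * ℙ c x) (pts c)

  fibre-secondMoment≤ :
    ∀ c H x → length x ≡ c → .{{_ : NonZero (s c)}} →
    let A = incidences (freeAt c H) x; M = incidences (fixedAt c H) x in
    ∑ (λ y → incidences H (y ∷ x) * incidences H (y ∷ x) * ℙ (suc c) (y ∷ x)) (upTo (s c))
      ≤ℚ ℙ c x * (A * A + θ c * (A * A + M * M + M * M))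
  fibre-secondMoment≤ c H x refl = begin
    ∑ (λ y → incidences H (y ∷ x) * incidences H (y ∷ x) * ℙ (suc c) (y ∷ x)) (upTo (s c))
      ≡⟨ ∑-cong (upTo (s c)) rearrange ⟩
    ∑ (λ y → ℙ c x * (w y * ((A + k y) * (A + k y)))) (upTo (s c))
      ≡⟨ ∑-*ˡ (ℙ c x) (λ y → w y * ((A + k y) * (A + k y))) (upTo (s c)) ⟩
    ℙ c x * ∑ (λ y → w y * ((A + k y) * (A + k y))) (upTo (s c))
      ≤⟨ *-monoˡ-≤-nonNeg′ (0≤ℙ c x) (∑-weighted-shifted-square≤ (upTo (s c)) w k
           (λ y → weight≤θ c x y) (∑-weight≤1 c x)
           (λ y → ∑-nonNeg Hfixed (λ h → 0≤𝟙 (matches h (y ∷ x)))) (λ y → incidences-∷≤ Hfixed y x)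
           (∑-incidences-∷-fixed≤ Hfixed x (s c) (All.all-filter (T? ∘ (λ h → fixed h c)) H))
           (∑-nonNeg Hfree (λ h → 0≤𝟙 (matches h x))) (0≤θ c)) ⟩
    ℙ c x * (A * A + θ c * (A * A + M * M + M * M)) ∎
    where
    open ≤-Reasoning
    Hfree  = freeAt c H
    Hfixed = fixedAt c H
    A = incidences Hfree x
    M = incidences Hfixed x
    w : ℕ → ℚ
    w y = reweight c x y * frac 1 (s c)
    k : ℕ → ℚ
    k y = incidences Hfixed (y ∷ x)
    incidences≡A+k : ∀ y → incidences H (y ∷ x) ≡ A + k y
    incidences≡A+k y = trans (incidences-split c H (y ∷ x))
      (cong (_+ k y) (incidences-∷-free Hfree y x (All.all-filter (T? ∘ (λ h → not (fixed h c))) H)))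
    rearrange : ∀ y → incidences H (y ∷ x) * incidences H (y ∷ x) * ℙ (suc c) (y ∷ x)
                    ≡ ℙ c x * (w y * ((A + k y) * (A + k y)))
    rearrange y rewrite incidences≡A+k y =
      solve 4 (λ i r p u → i :* i :* (r :* p :* u) := p :* (r :* u :* (i :* i)))
        refl (A + k y) (reweight c x y) (ℙ c x) (frac 1 (s c))
      where open +-*-Solver

  secondMoment-suc≤ :
    ∀ c H → .{{_ : NonZero (s c)}} →
    let A = secondMoment c (freeAt c H); M = secondMoment c (fixedAt c H) in
    secondMoment (suc c) H ≤ℚ A + θ c * (A + M + M)
  secondMoment-suc≤ c H = begin
    secondMoment (suc c) H
      ≡⟨ ∑-pts-suc c (λ p → incidences H p * incidences H p * ℙ (suc c) p) ⟩
    ∑ (λ x → ∑ (λ y → incidences H (y ∷ x) * incidences H (y ∷ x) * ℙ (suc c) (y ∷ x)) (upTo (s c))) (pts c)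
      ≤⟨ ∑-mono-≤-All (All.map (λ {x} len≡c → fibre-secondMoment≤ c H x len≡c) (pts-length c)) ⟩
    ∑ (λ x → ℙ c x * (a x * a x + θ c * (a x * a x + m x * m x + m x * m x))) (pts c)
      ≡⟨ ∑-cong (pts c) (λ x → solve 4 (λ p a m t → p :* (a :* a :+ t :* (a :* a :+ m :* m :+ m :* m))
                                                   := a :* a :* p :+ t :* (a :* a :* p :+ m :* m :* p :+ m :* m :* p))
                                        refl (ℙ c x) (a x) (m x) (θ c)) ⟩
    ∑ (λ x → a² x + θ c * (a² x + m² x + m² x)) (pts c)
      ≡⟨ ∑-+ a² (λ x → θ c * (a² x + m² x + m² x)) (pts c) ⟩
    A + ∑ (λ x → θ c * (a² x + m² x + m² x)) (pts c)
      ≡⟨ cong (A +_) (∑-*ˡ (θ c) (λ x → a² x + m² x + m² x) (pts c)) ⟩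
    A + θ c * ∑ (λ x → a² x + m² x + m² x) (pts c)
      ≡⟨ cong (λ t → A + θ c * t)
              (trans (∑-+ (λ x → a² x + m² x) m² (pts c)) (cong (_+ M) (∑-+ a² m² (pts c)))) ⟩
    A + θ c * (A + M + M) ∎
    where
    open ≤-Reasoning
    open +-*-Solver
    a m a² m² : List ℕ → ℚ
    a = incidences (freeAt c H)
    m = incidences (fixedAt c H)
    a² x = a x * a x * ℙ c x
    m² x = m x * m x * ℙ c x
    A = secondMoment c (freeAt c H)
    M = secondMoment c (fixedAt c H)

  secondMoment≤Π : ∀ c → (∀ j → j < c → NonZero (s j)) → ∀ H → Separated c H → secondMoment c H ≤ℚ Π c
  secondMoment≤Π zero    _       []           _                       = ≤ᵇ⇒≤ _
  secondMoment≤Π zero    _       (_ ∷ [])     _                       = ≤ᵇ⇒≤ _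
  secondMoment≤Π zero    _       (_ ∷ _ ∷ _)  ((disagree ∷ _) ∷ _)    = ⊥-elim (disagree (λ _ ()))
  secondMoment≤Π (suc c) nonZero H separated = begin
    secondMoment (suc c) H   ≤⟨ secondMoment-suc≤ c H ⟩
    A + θ c * (A + M + M)
      ≤⟨ +-mono-≤ A≤Π (*-monoˡ-≤-nonNeg′ (0≤θ c) (+-mono-≤ (+-mono-≤ A≤Π M≤Π) M≤Π)) ⟩
    Π c + θ c * (Π c + Π c + Π c)
      ≡⟨ solve 2 (λ p t → p :+ t :* (p :+ p :+ p) := p :* (con 1ℚ :+ con (ι 3) :* t)) refl (Π c) (θ c) ⟩
    Π c * (1ℚ + ι 3 * θ c)   ≡⟨ sym (Π-suc c) ⟩
    Π (suc c)                ∎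
    where
    open ≤-Reasoning
    open +-*-Solver
    instance _ = nonZero c (ℕ.n<1+n c)
    nonZero′ : ∀ j → j < c → NonZero (s j)
    nonZero′ j j<c = nonZero j (ℕ.m<n⇒m<1+n j<c)
    A = secondMoment c (freeAt c H)
    M = secondMoment c (fixedAt c H)
    A≤Π = secondMoment≤Π c nonZero′ (freeAt c H) (freeAt-separated c separated)
    M≤Π = secondMoment≤Π c nonZero′ (fixedAt c H) (fixedAt-separated c separated)

  Eα²≤secondMoment-level : ∀ c .{{_ : NonZero (s c)}} →
                           Eα² c ≤ℚ frac 1 (s c) * frac 1 (s c) * secondMoment c (level c 𝒜)
  Eα²≤secondMoment-level c = begin
    ∑ (λ x → α c x * α c x * ℙ c x) (pts c)
      ≤⟨ ∑-mono-≤-All (All.map (λ {x} len≡c → *-monoʳ-≤-nonNeg′ (0≤ℙ c x)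
                                                 (p*p≤q*q (0≤α c x) (α≤incidences-level c x len≡c)))
                               (pts-length c)) ⟩
    ∑ (λ x → (L x * u) * (L x * u) * ℙ c x) (pts c)
      ≡⟨ ∑-cong (pts c) (λ x → solve 3 (λ l u p → (l :* u) :* (l :* u) :* p := u :* u :* (l :* l :* p))
                                         refl (L x) u (ℙ c x)) ⟩
    ∑ (λ x → u * u * (L x * L x * ℙ c x)) (pts c)
      ≡⟨ ∑-*ˡ (u * u) (λ x → L x * L x * ℙ c x) (pts c) ⟩
    u * u * secondMoment c (level c 𝒜) ∎
    where
    open ≤-Reasoning
    open +-*-Solver
    u = frac 1 (s c)
    L = incidences (level c 𝒜)

lemma4p1 : (n : ℕ) → 1 ≤ n → (s : ℕ → ℕ) → (∀ i → i < n → 2 ≤ s i) →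
           (δ : ℚ) → 0ℚ ≤ℚ δ → δ ≤ℚ ½ →
           (𝒜 : List Hyp) → All (WellFormed n s) 𝒜 →
           AllPairs (λ h h′ → ¬ Parallel h h′) 𝒜 →
           ∀ c → c < n → Setup.Eα² n s δ 𝒜 c ≤ℚ Setup.bound n s δ 𝒜 c
lemma4p1 n _ s 2≤s δ 0≤δ δ≤½ 𝒜 wellFormed nonParallel c c<n = begin
  Eα² c                               ≤⟨ Eα²≤secondMoment-level c ⟩
  u * u * secondMoment c (level c 𝒜)  ≤⟨ *-monoˡ-≤-nonNeg′ (0≤p*q (frac-nonNeg 1 (s c)) (frac-nonNeg 1 (s c)))
                                           (secondMoment≤Π c (λ j j<c → nonZero j (ℕ.<⇒≤ j<c)) (level c 𝒜)
                                              (level-separated c wellFormed nonParallel)) ⟩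
  u * u * Π c                         ∎
  where
  open Setup n s δ 𝒜
  open Hyperplanes n s δ 𝒜
  open Reweighted n s δ 𝒜 0≤δ δ≤½
  open ≤-Reasoning
  u = frac 1 (s c)
  nonZero : ∀ j → j ≤ c → NonZero (s j)
  nonZero j j≤c = ℕ.>-nonZero (ℕ.<-≤-trans (ℕ.s≤s ℕ.z≤n) (2≤s j (ℕ.≤-<-trans j≤c c<n)))
  instance _ = nonZero c ℕ.≤-refl
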